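{- Let $G$ satisfy conditions (i)–(v), let $\zeta\ge1$ be an integer, and let $Y$ be a $(\zeta,\beta)$-core in $G$. Then at most $\alpha\tau 2^{\beta\zeta}$ vertices of $G$ are dense to $Y$.
   Context: Fixed parameters: integers $\tau\ge0$, $\alpha\ge1$, $\delta\ge1$, $\beta\ge2$ and a non-decreasing function $\theta:\mathbb{N}\to\mathbb{N}$. Graphs are finite and simple; $\chi(X)=\chi(G[X])$. For $k\ge1$, a $(k,\delta)$-broom is obtained from a $k$-edge path with ends $a,b$ by adding $\delta$ leaves adjacent to $b$ ($a$ is the handle); $T(\delta)$ is obtained from $\delta$ disjoint $(1,\delta)$-brooms and $\delta$ disjoint $(2,\delta)$-brooms by identifying their handles; $H$-free means no induced subgraph isomorphic to $H$. $\chi^2(G)=\max_v\chi(N^2[v])$ where $N^2[v]$ is the set of vertices at distance at most $2$ from $v$. $X\subseteq V(G)$ is matching-covered if each $x\in X$ has a neighbour $y\notin X$ adjacent to no other vertex of $X$. For $a,b\ge1$, an $(a,b)$-core is a set of $ab$ vertices partitioned into $b$ stable sets (parts) of size $a$ with all edges between distinct parts. Conditions: (i) $G$ is $T(\delta)$-free; (ii) $\chi^2(G)\le\tau$; (iii) every matching-covered set in $G$ has chromatic number at most $\tau$; (iv) for all $a\ge1$, if $\chi(G)>\theta(a)$ then $G$ has an $(a,\beta)$-core; (v) $G$ has no $(\alpha,\beta+1)$-core. A vertex $v\in V(G)\setminus Y$ is dense to a $(\zeta,\beta)$-core $Y$ if $v$ has at least $\alpha$ neighbours in each part of $Y$. 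-}

module Defs where

open import Data.Nat using (ℕ; zero; suc; _+_; _*_; _^_; _≤_; _<_)
open import Data.Bool using (Bool; true; false; T)
open import Data.Fin using (Fin; zero; suc)
open import Data.Product using (Σ; ∃; ∃-syntax; _×_; _,_)
open import Data.Sum using (_⊎_)
open import Data.List using (List; length)
open import Data.List.Relation.Unary.All using (All)
open import Data.List.Relation.Unary.Unique.Propositional using (Unique)
open import Relation.Nullary using (¬_)
open import Relation.Binary.PropositionalEquality using (_≡_; _≢_)

record Graph : Set where
  field
    n      : ℕ
    adj    : Fin n → Fin n → Bool
    sym    : ∀ u v → adj u v ≡ adj v u
    irrefl : ∀ u → adj u u ≡ false

module _ (G : Graph) where
  open Graph G

  Vtx : Set
  Vtx = Fin n

  Edge : Vtx → Vtx → Set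
  Edge u v = T (adj u v)

  VSet : Set₁
  VSet = Vtx → Set

  Everything : VSet
  Everything _ = Data.Unit.⊤
    where import Data.Unit

  Colourable : VSet → ℕ → Set
  Colourable X k = Σ (Vtx → Fin k) λ c →
    ∀ u v → X u → X v → Edge u v → c u ≢ c v

  N² : Vtx → VSet
  N² v u = (u ≡ v) ⊎ Edge v u ⊎ (∃[ w ] (Edge v w × Edge w u))

  Chi2≤ : ℕ → Set
  Chi2≤ τ = ∀ v → Colourable (N² v) τ

  MatchingCovered : VSet → Set
  MatchingCovered X = ∀ x → X x →
    ∃[ y ] (¬ X y × Edge x y × (∀ x' → X x' → Edge x' y → x' ≡ x))

  record Core (a b : ℕ) : Set where
    field
      vert      : Fin b → Fin a → Vtx
      injective : ∀ i j i' j' → vert i j ≡ vert i' j' → (i ≡ i') × (j ≡ j')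
      stable    : ∀ i j j' → ¬ Edge (vert i j) (vert i j')
      complete  : ∀ i i' j j' → i ≢ i' → Edge (vert i j) (vert i' j')

  InCore : ∀ {a b} → Core a b → VSet
  InCore Y v = ∃[ i ] ∃[ j ] (v ≡ Core.vert Y i j)

  countTrue : ∀ {m} → (Fin m → Bool) → ℕ
  countTrue {zero}  f = 0
  countTrue {suc m} f with f zero
  ... | true  = suc (countTrue (λ j → f (suc j)))
  ... | false = countTrue (λ j → f (suc j))

  Dense : ℕ → ∀ {a b} → Core a b → Vtx → Set
  Dense α {a} {b} Y v = ¬ InCore Y v ×
    (∀ (i : Fin b) → α ≤ countTrue (λ j → adj v (Core.vert Y i j)))

data TV (δ : ℕ) : Set where
  root : TV δ
  b1   : Fin δ → TV δ            -- centre b of the i-th (1,δ)-broom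
  l1   : Fin δ → Fin δ → TV δ    -- leaves of the i-th (1,δ)-broom
  m2   : Fin δ → TV δ            -- middle vertex of the i-th (2,δ)-broom
  b2   : Fin δ → TV δ            -- centre b of the i-th (2,δ)-broom
  l2   : Fin δ → Fin δ → TV δ    -- leaves of the i-th (2,δ)-broom

data TE {δ : ℕ} : TV δ → TV δ → Set where
  e-root-b1 : ∀ i → TE root (b1 i)
  e-b1-l1   : ∀ i j → TE (b1 i) (l1 i j)
  e-root-m2 : ∀ i → TE root (m2 i)
  e-m2-b2   : ∀ i → TE (m2 i) (b2 i)
  e-b2-l2   : ∀ i j → TE (b2 i) (l2 i j)

TAdj : ∀ {δ} → TV δ → TV δ → Set
TAdj u v = TE u v ⊎ TE v u

HasInducedT : Graph → ℕ → Set
HasInducedT G δ = Σ (TV δ → Vtx G) λ f →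
  (∀ u v → f u ≡ f v → u ≡ v) ×
  (∀ u v → (TAdj u v → Edge G (f u) (f v)) × (Edge G (f u) (f v) → TAdj u v))

NonDecreasing : (ℕ → ℕ) → Set
NonDecreasing θ = ∀ {x y} → x ≤ y → θ x ≤ θ y

record Conditions (τ α δ β : ℕ) (θ : ℕ → ℕ) (G : Graph) : Set₁ where
  field
    cond-i   : ¬ HasInducedT G δ
    cond-ii  : Chi2≤ G τ
    cond-iii : ∀ (X : VSet G) → MatchingCovered G X → Colourable G X τ
    cond-iv  : ∀ a → 1 ≤ a → ¬ Colourable G (Everything G) (θ a) → Core G a β
    cond-v   : ¬ Core G α (suc β)

module Submission where

-- Group the dense vertices by their adjacency pattern to Y; there are at most
-- 2^(βζ) patterns.  Vertices sharing the pattern of v are adjacent to a common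
-- neighbour y of v in Y, so they lie in N²[y] and split into τ colour classes of
-- a colouring of N²[y].  A colour class is stable, so α of its vertices together
-- with α neighbours of v in each part of Y would form an (α, β+1)-core; hence each
-- class has fewer than α vertices.  Only conditions (ii) and (v) are needed.

open import Defs
open import Data.Bool using (Bool; true; false; T)
open import Data.Empty using (⊥-elim)
open import Data.Fin using (Fin; zero; suc; combine; remQuot; funToFin; finToFun; fromℕ<)
  renaming (_≟_ to _≟ᶠ_)
open import Data.Fin.Properties using (2↔Bool; suc-injective; finToFun-funToFin; remQuot-combine)
open import Data.List using (List; []; _∷_; length; filter; allFin)
open import Data.List.Properties using (length-tabulate)
open import Data.List.Membership.Propositional using (_∈_)
open import Data.List.Membership.Propositional.Properties using (∈-allFin)
open import Data.List.Relation.Unary.All as All using (All; []; _∷_)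
import Data.List.Relation.Unary.All.Properties as Allₚ
open import Data.List.Relation.Unary.Any using (here; there)
open import Data.List.Relation.Unary.AllPairs using (_∷_)
open import Data.List.Relation.Unary.Unique.Propositional using (Unique)
import Data.List.Relation.Unary.Unique.Propositional.Properties as Uniqueₚ
open import Data.Nat using (ℕ; zero; suc; _+_; _*_; _^_; _≤_; z≤n; s≤s; pred; _<?_)
open import Data.Nat.Properties
  using (+-suc; +-mono-≤; *-comm; *-monoʳ-≤; pred[n]≤n; <⇒≤pred; ≮⇒≥; ≤-trans;
         module ≤-Reasoning)
open import Data.Product using (_×_; _,_; proj₁; proj₂)
open import Data.Sum using (inj₁; inj₂)
open import Data.Unit using (tt)
open import Function.Base using (_∘_)
open import Function.Bundles using (Inverse; Injection)
open import Function.Definitions using (Injective)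
open import Function.Properties.Inverse using (↔-sym; ↔⇒↣)
open import Relation.Binary.Definitions using (DecidableEquality)
open import Relation.Nullary using (¬_; yes; no; ¬?; does)
open import Relation.Unary using (Decidable)
open import Relation.Binary.PropositionalEquality
  using (_≡_; _≢_; refl; sym; trans; cong; subst; module ≡-Reasoning)

length-filter-split : ∀ {A : Set} {Q : A → Set} (Q? : Decidable Q) xs →
  length xs ≡ length (filter Q? xs) + length (filter (¬? ∘ Q?) xs)
length-filter-split Q? [] = refl
length-filter-split Q? (x ∷ xs) with does (Q? x)
... | true  = cong suc (length-filter-split Q? xs)
... | false = trans (cong suc (length-filter-split Q? xs)) (sym (+-suc _ _))

module _ {A B : Set} (_≟_ : DecidableEquality B) (key : A → B) {P : A → Set} {c : ℕ}
         (fibre-bound : ∀ b L → Unique L → All P L → All (λ x → key x ≡ b) L → length L ≤ c)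
         where

  length≤-fibres : ∀ bs D → Unique D → All P D → All (λ x → key x ∈ bs) D → length D ≤ length bs * c
  length≤-fibres []       []      _  _  _        = z≤n
  length≤-fibres []       (_ ∷ _) _  _  (() ∷ _)
  length≤-fibres (b ∷ bs) D       uD pD kD       = begin
    length D                                       ≡⟨ length-filter-split at-b D ⟩
    length (filter at-b D) + length (filter off-b D) ≤⟨ +-mono-≤ on-fibre off-fibre ⟩
    c + length bs * c                              ∎
    where
      open ≤-Reasoning
      at-b  = λ x → key x ≟ b
      off-b = ¬? ∘ at-b

      on-fibre : length (filter at-b D) ≤ c
      on-fibre = fibre-bound b _ (Uniqueₚ.filter⁺ at-b uD) (Allₚ.filter⁺ at-b pD)
        (Allₚ.all-filter at-b D)

      drop-b : ∀ {x} → key x ∈ b ∷ bs × key x ≢ b → key x ∈ bs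
      drop-b (here  e , ≢b) = ⊥-elim (≢b e)
      drop-b (there e , _)  = e

      off-fibre : length (filter off-b D) ≤ length bs * c
      off-fibre = length≤-fibres bs _ (Uniqueₚ.filter⁺ off-b uD) (Allₚ.filter⁺ off-b pD)
        (All.zipWith drop-b (Allₚ.filter⁺ off-b kD , Allₚ.all-filter off-b D))

length≤-finFibres : ∀ {A : Set} {k c} (key : A → Fin k) {P : A → Set} →
  (∀ b L → Unique L → All P L → All (λ x → key x ≡ b) L → length L ≤ c) →
  ∀ D → Unique D → All P D → length D ≤ k * c
length≤-finFibres {k = k} {c} key fibre-bound D uD pD =
  subst (λ m → length D ≤ m * c) (length-tabulate {n = k} (λ i → i))
    (length≤-fibres _≟ᶠ_ key fibre-bound (allFin k) D uD pD (All.tabulate (λ {x} _ → ∈-allFin (key x))))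

record Distinct {A : Set} (P : A → Set) (a : ℕ) : Set where
  field
    element   : Fin a → A
    injective : Injective _≡_ _≡_ element
    satisfies : ∀ j → P (element j)

none : ∀ {A : Set} {P : A → Set} → Distinct P 0
none = record { element = λ () ; injective = λ {} ; satisfies = λ () }

Distinct-suc : ∀ {m} {P : Fin (suc m) → Set} {a} → Distinct (P ∘ suc) a → Distinct P a
Distinct-suc d = record
  { element = suc ∘ element ; injective = injective ∘ suc-injective ; satisfies = satisfies }
  where open Distinct d

cons : ∀ {A : Set} {P : A → Set} {a} (x : A) → P x → (d : Distinct P a) →
  (∀ j → Distinct.element d j ≢ x) → Distinct P (suc a)
cons {A} {P} {a} x px d fresh = record
  { element = element′ ; injective = injective′ ; satisfies = satisfies′ }
  where
    open Distinct d

    element′ : Fin (suc a) → A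
    element′ zero    = x
    element′ (suc j) = element j

    injective′ : Injective _≡_ _≡_ element′
    injective′ {zero}  {zero}   _ = refl
    injective′ {zero}  {suc j′} e = ⊥-elim (fresh j′ (sym e))
    injective′ {suc j} {zero}   e = ⊥-elim (fresh j e)
    injective′ {suc j} {suc j′} e = cong suc (injective e)

    satisfies′ : ∀ j → P (element′ j)
    satisfies′ zero    = px
    satisfies′ (suc j) = satisfies j

selectFromList : ∀ {A : Set} {P : A → Set} {a} {L : List A} →
  Unique L → All P L → a ≤ length L → Distinct P a
selectFromList {a = zero} _ _ _ = none
selectFromList {P = P} {a = suc a} {x ∷ L} (x∉L ∷ uL) (px ∷ pL) (s≤s a≤L) =
  cons x px (record { element = element ; injective = injective ; satisfies = proj₁ ∘ satisfies })
    (λ j → proj₂ (satisfies j) ∘ sym)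
  where open Distinct (selectFromList {P = λ y → P y × x ≢ y} uL (All.zip (pL , x∉L)) a≤L)

funToFin-injective : ∀ {m n} {f g : Fin m → Fin n} → funToFin f ≡ funToFin g → ∀ i → f i ≡ g i
funToFin-injective {f = f} {g} e i = begin
  f i                     ≡⟨ sym (finToFun-funToFin f i) ⟩
  finToFun (funToFin f) i ≡⟨ cong (λ k → finToFun k i) e ⟩
  finToFun (funToFin g) i ≡⟨ finToFun-funToFin g i ⟩
  g i                     ∎
  where open ≡-Reasoning

boolToFin : Bool → Fin 2
boolToFin = Inverse.from 2↔Bool

boolToFin-injective : Injective _≡_ _≡_ boolToFin
boolToFin-injective = Injection.injective (↔⇒↣ (↔-sym 2↔Bool))

module _ (G : Graph) where
  open Graph G using (adj)

  Edge-sym : ∀ {u v} → Edge G u v → Edge G v u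
  Edge-sym {u} {v} = subst T (Graph.sym G u v)

  selectTrue : ∀ {m} (f : Fin m → Bool) {a} → a ≤ countTrue G f → Distinct (T ∘ f) a
  selectTrue {zero} f {zero} _ = none
  selectTrue {suc m} f {a} a≤count with f zero in f0
  ... | false = Distinct-suc (selectTrue (f ∘ suc) a≤count)
  selectTrue {suc m} f {zero}  _           | true = none
  selectTrue {suc m} f {suc a} (s≤s a≤count) | true =
    cons zero (subst T (sym f0) tt) (Distinct-suc (selectTrue (f ∘ suc) a≤count)) (λ _ ())

  restrictCore : ∀ {ζ a b} (Y : Core G ζ b) (s : Fin b → Fin a → Fin ζ) →
    (∀ i → Injective _≡_ _≡_ (s i)) → Core G a b
  restrictCore Y s s-injective = record
    { vert      = λ i j → vert i (s i j)
    ; injective = injective′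
    ; stable    = λ i j j′ → stable i (s i j) (s i j′)
    ; complete  = λ i i′ j j′ → complete i i′ (s i j) (s i′ j′)
    }
    where
      open Core Y
      injective′ : ∀ i j i′ j′ → vert i (s i j) ≡ vert i′ (s i′ j′) → (i ≡ i′) × (j ≡ j′)
      injective′ i j i′ j′ e with injective i (s i j) i′ (s i′ j′) e
      ... | refl , e′ = refl , s-injective i e′

  extendCore : ∀ {a b} (X : Core G a b) (I : Fin a → Vtx G) → Injective _≡_ _≡_ I →
    (∀ j → ¬ InCore G X (I j)) → (∀ j j′ → ¬ Edge G (I j) (I j′)) →
    (∀ j i l → Edge G (I j) (Core.vert X i l)) → Core G a (suc b)
  extendCore {a} {b} X I I-injective outside independent adjacent = record
    { vert = vert′ ; injective = injective′ ; stable = stable′ ; complete = complete′ }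
    where
      open Core X

      vert′ : Fin (suc b) → Fin a → Vtx G
      vert′ zero    = I
      vert′ (suc i) = vert i

      injective′ : ∀ i j i′ j′ → vert′ i j ≡ vert′ i′ j′ → (i ≡ i′) × (j ≡ j′)
      injective′ zero    j zero     j′ e = refl , I-injective e
      injective′ zero    j (suc i′) j′ e = ⊥-elim (outside j (i′ , j′ , e))
      injective′ (suc i) j zero     j′ e = ⊥-elim (outside j′ (i , j , sym e))
      injective′ (suc i) j (suc i′) j′ e with injective i j i′ j′ e
      ... | refl , j≡j′ = refl , j≡j′

      stable′ : ∀ i j j′ → ¬ Edge G (vert′ i j) (vert′ i j′)
      stable′ zero    = independent
      stable′ (suc i) = stable i

      complete′ : ∀ i i′ j j′ → i ≢ i′ → Edge G (vert′ i j) (vert′ i′ j′)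
      complete′ zero    zero     j j′ i≢i′ = ⊥-elim (i≢i′ refl)
      complete′ zero    (suc i′) j j′ _    = adjacent j i′ j′
      complete′ (suc i) zero     j j′ _    = Edge-sym (adjacent j′ i j)
      complete′ (suc i) (suc i′) j j′ i≢i′ = complete i i′ j j′ (i≢i′ ∘ cong suc)

module DenseVertices {τ α β ζ : ℕ} (G : Graph) (χ²≤τ : Chi2≤ G τ) (no-core : ¬ Core G α (suc β))
                     (Y : Core G ζ β) where
  open Graph G using (adj)
  module Y = Core Y

  adjacencies : Vtx G → Fin β × Fin ζ → Bool
  adjacencies v (i , j) = adj v (Y.vert i j)

  SamePattern : Vtx G → Vtx G → Set
  SamePattern u v = ∀ i j → adjacencies u (i , j) ≡ adjacencies v (i , j)

  patternCode : Vtx G → Fin (2 ^ (β * ζ))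
  patternCode v = funToFin {β * ζ} (boolToFin ∘ adjacencies v ∘ remQuot ζ)

  patternCode-injective : ∀ {u v} → patternCode u ≡ patternCode v → SamePattern u v
  patternCode-injective {u} {v} e i j = begin
    adjacencies u (i , j)                    ≡⟨ cong (adjacencies u) (sym (remQuot-combine i j)) ⟩
    adjacencies u (remQuot ζ (combine i j)) ≡⟨ boolToFin-injective (funToFin-injective e (combine i j)) ⟩
    adjacencies v (remQuot ζ (combine i j)) ≡⟨ cong (adjacencies v) (remQuot-combine i j) ⟩
    adjacencies v (i , j)                    ∎
    where open ≡-Reasoning

  DenseWithPattern : Vtx G → VSet G
  DenseWithPattern v x = Dense G α Y x × SamePattern x v

  coreFromStableClass : ∀ {v} → Dense G α Y v → (S : VSet G) → (∀ {x x′} → S x → S x′ → ¬ Edge G x x′) →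
    Distinct (λ x → DenseWithPattern v x × S x) α → Core G α (suc β)
  coreFromStableClass {v} (_ , α≤nbrs) S stable I =
    extendCore G Y′ I.element I.injective outside independent adjacent
    where
      module I = Distinct I

      nbrs : ∀ i → Distinct (λ j → Edge G v (Y.vert i j)) α
      nbrs i = selectTrue G (λ j → adj v (Y.vert i j)) (α≤nbrs i)

      Y′ : Core G α β
      Y′ = restrictCore G Y (Distinct.element ∘ nbrs) (Distinct.injective ∘ nbrs)

      outside : ∀ j → ¬ InCore G Y′ (I.element j)
      outside j (i , l , e) = proj₁ (proj₁ (proj₁ (I.satisfies j))) (i , _ , e)

      independent : ∀ j j′ → ¬ Edge G (I.element j) (I.element j′)
      independent j j′ = stable (proj₂ (I.satisfies j)) (proj₂ (I.satisfies j′))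

      adjacent : ∀ j i l → Edge G (I.element j) (Core.vert Y′ i l)
      adjacent j i l = subst T (sym (proj₂ (proj₁ (I.satisfies j)) i _)) (Distinct.satisfies (nbrs i) l)

  module _ (i₀ : Fin β) (1≤α : 1 ≤ α) where

    samePattern-bound : ∀ {v} → Dense G α Y v →
      ∀ L → Unique L → All (DenseWithPattern v) L → length L ≤ τ * pred α
    samePattern-bound {v} dense-v = length≤-finFibres colour colour-class-bound
      where
        nbr : Distinct (λ j → Edge G v (Y.vert i₀ j)) 1
        nbr = selectTrue G (λ j → adj v (Y.vert i₀ j)) (≤-trans 1≤α (proj₂ dense-v i₀))

        y = Y.vert i₀ (Distinct.element nbr zero)
        colour = proj₁ (χ²≤τ y)

        near-y : ∀ {x} → SamePattern x v → N² G y x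
        near-y same = inj₂ (inj₁ (Edge-sym G (subst T (sym (same i₀ _)) (Distinct.satisfies nbr zero))))

        colour-class-bound : ∀ c L → Unique L → All (DenseWithPattern v) L →
          All (λ x → colour x ≡ c) L → length L ≤ pred α
        colour-class-bound c L uL pL cL with length L <? α
        ... | yes small = <⇒≤pred small
        ... | no  large = ⊥-elim (no-core (coreFromStableClass dense-v ColourClass stable
              (selectFromList uL (All.zipWith (λ ((d , same) , cx) → (d , same) , same , cx) (pL , cL))
                (≮⇒≥ large))))
          where
            ColourClass : VSet G
            ColourClass x = SamePattern x v × colour x ≡ c

            stable : ∀ {x x′} → ColourClass x → ColourClass x′ → ¬ Edge G x x′
            stable (same , cx) (same′ , cx′) edge =
              proj₂ (χ²≤τ y) _ _ (near-y same) (near-y same′) edge (trans cx (sym cx′))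

    dense-bound : ∀ D → Unique D → All (Dense G α Y) D → length D ≤ 2 ^ (β * ζ) * (τ * pred α)
    dense-bound = length≤-finFibres patternCode patternClass-bound
      where
        patternClass-bound : ∀ p L → Unique L → All (Dense G α Y) L → All (λ x → patternCode x ≡ p) L →
          length L ≤ τ * pred α
        patternClass-bound p []      _  _  _           = z≤n
        patternClass-bound p (v ∷ L) uL dL (pv≡p ∷ pL) = samePattern-bound (All.head dL) (v ∷ L) uL
          (All.zipWith (λ (d , px≡p) → d , patternCode-injective (trans px≡p (sym pv≡p)))
            (dL , pv≡p ∷ pL))

mainTheorem6 : (τ α δ β : ℕ) (θ : ℕ → ℕ) → 1 ≤ α → 1 ≤ δ → 2 ≤ β → NonDecreasing θ →
    (G : Graph) → Conditions τ α δ β θ G →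
    (ζ : ℕ) → 1 ≤ ζ → (Y : Core G ζ β) →
    (D : List (Vtx G)) → Unique D → All (Dense G α Y) D →
    length D ≤ α * τ * 2 ^ (β * ζ)
mainTheorem6 τ α δ β θ 1≤α _ 2≤β _ G conditions ζ _ Y D uD dD = begin
  length D                      ≤⟨ dense-bound (fromℕ< 2≤β) 1≤α D uD dD ⟩
  2 ^ (β * ζ) * (τ * pred α)    ≤⟨ *-monoʳ-≤ (2 ^ (β * ζ)) (*-monoʳ-≤ τ pred[n]≤n) ⟩
  2 ^ (β * ζ) * (τ * α)         ≡⟨ *-comm (2 ^ (β * ζ)) (τ * α) ⟩
  τ * α * 2 ^ (β * ζ)           ≡⟨ cong (_* 2 ^ (β * ζ)) (*-comm τ α) ⟩
  α * τ * 2 ^ (β * ζ)           ∎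
  where
    open ≤-Reasoning
    open Conditions conditions using (cond-ii; cond-v)
    open DenseVertices G cond-ii cond-v Y using (dense-bound)
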